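{- Let $\mathcal{G}$ be a $d$-uniform hypergraph with adjacency matrix $\mathbb{A}$, and let $P$ be (the color matrix of) a perfect coloring of $\mathcal{G}$ with $d$-dimensional parameter matrix $\mathbb{S}$. If $(\lambda,x)$ is an eigenpair for $\mathbb{S}$, then $(\lambda,Px)$ is an eigenpair for $\mathbb{A}$.
   Context: A $d$-uniform hypergraph on vertex set $[n]$ has $d$-element hyperedges. Its adjacency matrix $\mathbb{A}$ is the $d$-dimensional array with $a_{(x_1,\dots,x_d)}=1/(d-1)!$ if $\{x_1,\dots,x_d\}$ is a hyperedge, and $0$ otherwise. A coloring is a surjective map $f:[n]\to[k]$ with color matrix $P$ ($n\times k$, $p_{x,i}=1$ iff $f(x)=i$). We use $$(\mathbb{A}\circ P)_{x,j_1,\dots,j_{d-1}}=\sum_{x_1,\dots,x_{d-1}}a_{x,x_1,\dots,x_{d-1}}p_{x_1,j_1}\cdots p_{x_{d-1},j_{d-1}},\qquad (P\circ\mathbb{S})_{x,\beta}=\sum_ip_{x,i}s_{i,\beta}.$$ The coloring is perfect if there is a $d$-dimensional $\mathbb{S}$ of order $k$ with $\mathbb{A}\circ P=P\circ\mathbb{S}$ (equivalently, all vertices of the same color lie in equally many hyperedges of each color range); this $\mathbb{S}$ is the parameter matrix. For a $d$-dimensional matrix $\mathbb{M}$ of order $m$ and $x\in\mathbb{C}^m$, $(\mathbb{M}\circ x)_i=\sum_{i_2,\dots,i_d}m_{i,i_2,\dots,i_d}x_{i_2}\cdots x_{i_d}$ and $\mathbb{I}\circ x=(x_1^{d-1},\dots,x_m^{d-1})$.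 A pair $(\lambda,x)$ with $\lambda\in\mathbb{C}$ and $x\neq0$ is an eigenpair of $\mathbb{M}$ if $\mathbb{M}\circ x=\lambda(\mathbb{I}\circ x)$. -}

module Defs where

open import Level using (Level)
open import Data.Nat using (ℕ; zero; suc)
open import Data.Bool using (Bool; true; false; if_then_else_; _∨_)
open import Data.Fin using (Fin; _≟_)
open import Data.Fin.Subset using (Subset)
open import Data.Vec using (tabulate)
open import Data.Vec.Functional using (_∷_)
open import Relation.Nullary.Decidable using (isYes)
open import Relation.Nullary using (¬_)
open import Relation.Binary.PropositionalEquality using (_≡_)
open import Data.Product using (Σ; ∃; _×_)
open import Algebra.Bundles using (CommutativeRing)

anyᶠ : ∀ {d} → (Fin d → Bool) → Bool
anyᶠ {zero}  f = false
anyᶠ {suc d} f = f Data.Fin.zero ∨ anyᶠ (λ j → f (Data.Fin.suc j))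


image : ∀ {d n} → (Fin d → Fin n) → Subset n
image t = tabulate (λ v → anyᶠ (λ j → isYes (t j ≟ v)))

record UniformHypergraph (d n : ℕ) : Set where
  field
    isEdge  : Subset n → Bool
    uniform : ∀ s → isEdge s ≡ true → Data.Fin.Subset.∣ s ∣ ≡ d

module _ {c ℓ : Level} (R : CommutativeRing c ℓ) where
  open CommutativeRing R

  sumᶠ : ∀ {n} → (Fin n → Carrier) → Carrier
  sumᶠ {zero}  f = 0#
  sumᶠ {suc n} f = f Data.Fin.zero + sumᶠ (λ j → f (Data.Fin.suc j))

  prodᶠ : ∀ {m} → (Fin m → Carrier) → Carrier
  prodᶠ {zero}  f = 1#
  prodᶠ {suc m} f = f Data.Fin.zero * prodᶠ (λ j → f (Data.Fin.suc j))

  sumTuples : ∀ m {n} → ((Fin m → Fin n) → Carrier) → Carrier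
  sumTuples zero    f = f (λ ())
  sumTuples (suc m) f = sumᶠ (λ j → sumTuples m (λ u → f (j ∷ u)))

  pow : Carrier → ℕ → Carrier
  pow x zero    = 1#
  pow x (suc k) = x * pow x k

  ℕtoR : ℕ → Carrier
  ℕtoR zero    = 0#
  ℕtoR (suc k) = 1# + ℕtoR k

  -- A (suc m)-dimensional matrix of order n (with entries in R):
  -- entry m_{i,i_2,...,i_d} is  M i (i_2,...,i_d).
  Tensor : ℕ → ℕ → ℕ → Set c
  Tensor m r s = Fin r → (Fin m → Fin s) → Carrier

  applyT : ∀ {m n} → Tensor m n n → (Fin n → Carrier) → Fin n → Carrier
  applyT {m} M x i = sumTuples m (λ u → M i u * prodᶠ (λ l → x (u l)))

  identityApply : ∀ {m n} → (Fin n → Carrier) → Fin n → Carrier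
  identityApply {m} x i = pow (x i) m

  IsEigenpair : ∀ {m n} → Tensor m n n → Carrier → (Fin n → Carrier) → Set ℓ
  IsEigenpair {m} M λ' x =
    (¬ (∀ i → x i ≈ 0#)) × (∀ i → applyT M x i ≈ λ' * identityApply {m} x i)

  -- adjacency matrix; inv plays the role of 1/(d-1)! (d = suc m)
  adjacency : ∀ {m n} → UniformHypergraph (suc m) n → Carrier → Tensor m n n
  adjacency G inv x u =
    if UniformHypergraph.isEdge G (image (x ∷ u)) then inv else 0#

  colorMatrix : ∀ {n k} → (Fin n → Fin k) → Fin n → Fin k → Carrier
  colorMatrix f x i = if isYes (f x ≟ i) then 1# else 0#

  tensorCompMat : ∀ {m n k} → Tensor m n n → (Fin n → Fin k → Carrier) → Tensor m n k
  tensorCompMat {m} A P x j =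
    sumTuples m (λ u → A x u * prodᶠ (λ l → P (u l) (j l)))

  matCompTensor : ∀ {m n k} → (Fin n → Fin k → Carrier) → Tensor m k k → Tensor m n k
  matCompTensor P S x β = sumᶠ (λ i → P x i * S i β)

  matVec : ∀ {n k} → (Fin n → Fin k → Carrier) → (Fin k → Carrier) → Fin n → Carrier
  matVec P x v = sumᶠ (λ i → P v i * x i)

  Surjective : ∀ {n k} → (Fin n → Fin k) → Set
  Surjective f = ∀ i → ∃ λ x → f x ≡ i

  IsParameterMatrix : ∀ {m n k} → Tensor m n n → (Fin n → Fin k) → Tensor m k k → Set ℓ
  IsParameterMatrix A f S =
    ∀ x β → tensorCompMat A (colorMatrix f) x β ≈ matCompTensor (colorMatrix f) S x β

-- For a perfect coloring the identity A ∘ P = P ∘ S gives, for any vector x,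
-- A ∘ (P x) = P (S ∘ x), because multilinearity lets P be moved through the tensor product
-- one slot at a time. Since P x takes the value x (f v) at v, both sides of the eigen-equation
-- of S are transported to those of A; surjectivity of f makes P x nonzero when x is.
module Submission where

open import Defs
open import Level using (Level)
open import Data.Nat using (ℕ; zero; suc; _≤_; _!)
open import Data.Fin using (Fin; _≟_; punchIn) renaming (zero to fzero; suc to fsuc)
open import Data.Fin.Properties using (punchInᵢ≢i)
open import Data.Vec.Functional using (_∷_)
open import Data.Product using (∃; _,_)
open import Relation.Nullary using (¬_; yes; no; contradiction)
open import Relation.Binary.PropositionalEquality as ≡ using (_≡_; _≢_)
open import Algebra.Bundles using (CommutativeRing)
import Algebra.Properties.CommutativeMonoid.Sum as MonoidSum
import Relation.Binary.Reasoning.Setoid as SetoidReasoning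

module FiniteSums {c ℓ : Level} (R : CommutativeRing c ℓ) where
  open CommutativeRing R
  open SetoidReasoning setoid
  open import Algebra.Properties.Semiring.Sum semiring
    using (sum; sum-cong-≋; sum-cong-≗; sum-replicate-zero; sum-remove; ∑-comm; *-distribˡ-sum)
  module Product = MonoidSum *-commutativeMonoid

  sumᶠ≡sum : ∀ {n} (f : Fin n → Carrier) → sumᶠ R f ≡ sum f
  sumᶠ≡sum {zero}  f = ≡.refl
  sumᶠ≡sum {suc n} f = ≡.cong (f fzero +_) (sumᶠ≡sum (λ i → f (fsuc i)))

  prodᶠ≡product : ∀ {n} (f : Fin n → Carrier) → prodᶠ R f ≡ Product.sum f
  prodᶠ≡product {zero}  f = ≡.refl
  prodᶠ≡product {suc n} f = ≡.cong (f fzero *_) (prodᶠ≡product (λ i → f (fsuc i)))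

  sumᶠ-cong : ∀ {n} {f g : Fin n → Carrier} → (∀ i → f i ≈ g i) → sumᶠ R f ≈ sumᶠ R g
  sumᶠ-cong {f = f} {g} f≈g = begin
    sumᶠ R f ≡⟨ sumᶠ≡sum f ⟩
    sum f    ≈⟨ sum-cong-≋ f≈g ⟩
    sum g    ≡⟨ sumᶠ≡sum g ⟨
    sumᶠ R g ∎

  sumᶠ-*ˡ : ∀ {n} a (f : Fin n → Carrier) → sumᶠ R (λ i → a * f i) ≈ a * sumᶠ R f
  sumᶠ-*ˡ a f = begin
    sumᶠ R (λ i → a * f i) ≡⟨ sumᶠ≡sum (λ i → a * f i) ⟩
    sum (λ i → a * f i)    ≈⟨ *-distribˡ-sum a f ⟨
    a * sum f              ≡⟨ ≡.cong (a *_) (sumᶠ≡sum f) ⟨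
    a * sumᶠ R f           ∎

  sumᶠ-comm : ∀ {n k} (g : Fin n → Fin k → Carrier) →
    sumᶠ R (λ i → sumᶠ R (g i)) ≈ sumᶠ R (λ j → sumᶠ R (λ i → g i j))
  sumᶠ-comm g = begin
    sumᶠ R (λ i → sumᶠ R (g i))           ≡⟨ nested g ⟩
    sum (λ i → sum (g i))                 ≈⟨ ∑-comm g ⟩
    sum (λ j → sum (λ i → g i j))         ≡⟨ nested (λ j i → g i j) ⟨
    sumᶠ R (λ j → sumᶠ R (λ i → g i j))   ∎
    where
    nested : ∀ {n k} (h : Fin n → Fin k → Carrier) →
      sumᶠ R (λ i → sumᶠ R (h i)) ≡ sum (λ i → sum (h i))
    nested h = ≡.trans (sumᶠ≡sum (λ i → sumᶠ R (h i))) (sum-cong-≗ (λ i → sumᶠ≡sum (h i)))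

  prodᶠ-* : ∀ {n} (f g : Fin n → Carrier) → prodᶠ R (λ i → f i * g i) ≈ prodᶠ R f * prodᶠ R g
  prodᶠ-* f g = begin
    prodᶠ R (λ i → f i * g i)          ≡⟨ prodᶠ≡product (λ i → f i * g i) ⟩
    Product.sum (λ i → f i * g i)      ≈⟨ Product.∑-distrib-+ f g ⟩
    Product.sum f * Product.sum g      ≡⟨ ≡.cong₂ _*_ (prodᶠ≡product f) (prodᶠ≡product g) ⟨
    prodᶠ R f * prodᶠ R g              ∎

  -- Only the a-th term survives, the others being indexed by punchIn a.
  sumᶠ-select : ∀ {n} (δ x : Fin n → Carrier) (a : Fin n) → δ a ≈ 1# →
    (∀ i → i ≢ a → δ i ≈ 0#) → sumᶠ R (λ i → δ i * x i) ≈ x a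
  sumᶠ-select {suc n} δ x a δa≈1 δi≈0 = begin
    sumᶠ R (λ i → δ i * x i)
      ≡⟨ sumᶠ≡sum (λ i → δ i * x i) ⟩
    sum (λ i → δ i * x i)
      ≈⟨ sum-remove {i = a} (λ i → δ i * x i) ⟩
    δ a * x a + sum {n} (λ j → δ (punchIn a j) * x (punchIn a j))
      ≈⟨ +-cong (*-congʳ δa≈1) (sum-cong-≋ {n} λ j → *-congʳ (δi≈0 _ (punchInᵢ≢i a j))) ⟩
    1# * x a + sum {n} (λ j → 0# * x (punchIn a j))
      ≈⟨ +-cong (*-identityˡ (x a)) (sum-cong-≋ {n} λ j → zeroˡ (x (punchIn a j))) ⟩
    x a + sum {n} (λ _ → 0#)
      ≈⟨ +-congˡ (sum-replicate-zero n) ⟩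
    x a + 0#
      ≈⟨ +-identityʳ (x a) ⟩
    x a ∎

  sumTuples-cong : ∀ m {n} {f g : (Fin m → Fin n) → Carrier} →
    (∀ u → f u ≈ g u) → sumTuples R m f ≈ sumTuples R m g
  sumTuples-cong zero    f≈g = f≈g _
  sumTuples-cong (suc m) f≈g = sumᶠ-cong (λ j → sumTuples-cong m (λ u → f≈g (j ∷ u)))

  sumTuples-*ˡ : ∀ m {n} a (f : (Fin m → Fin n) → Carrier) →
    sumTuples R m (λ u → a * f u) ≈ a * sumTuples R m f
  sumTuples-*ˡ zero    a f = refl
  sumTuples-*ˡ (suc m) {n} a f = begin
    sumᶠ R (λ j → sumTuples R m (λ u → a * f (j ∷ u)))
      ≈⟨ sumᶠ-cong {n} (λ j → sumTuples-*ˡ m a (λ u → f (j ∷ u))) ⟩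
    sumᶠ R (λ j → a * sumTuples R m (λ u → f (j ∷ u)))
      ≈⟨ sumᶠ-*ˡ {n} a _ ⟩
    a * sumTuples R (suc m) f ∎

  sumTuples-*ʳ : ∀ m {n} a (f : (Fin m → Fin n) → Carrier) →
    sumTuples R m (λ u → f u * a) ≈ sumTuples R m f * a
  sumTuples-*ʳ m a f = begin
    sumTuples R m (λ u → f u * a) ≈⟨ sumTuples-cong m (λ u → *-comm (f u) a) ⟩
    sumTuples R m (λ u → a * f u) ≈⟨ sumTuples-*ˡ m a f ⟩
    a * sumTuples R m f           ≈⟨ *-comm a _ ⟩
    sumTuples R m f * a           ∎

  sumTuples-sumᶠ-comm : ∀ m {n k} (g : (Fin m → Fin n) → Fin k → Carrier) →
    sumTuples R m (λ u → sumᶠ R (g u)) ≈ sumᶠ R (λ j → sumTuples R m (λ u → g u j))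
  sumTuples-sumᶠ-comm zero    g = refl
  sumTuples-sumᶠ-comm (suc m) g = begin
    sumᶠ R (λ i → sumTuples R m (λ u → sumᶠ R (g (i ∷ u))))
      ≈⟨ sumᶠ-cong (λ i → sumTuples-sumᶠ-comm m (λ u → g (i ∷ u))) ⟩
    sumᶠ R (λ i → sumᶠ R (λ j → sumTuples R m (λ u → g (i ∷ u) j)))
      ≈⟨ sumᶠ-comm (λ i j → sumTuples R m (λ u → g (i ∷ u) j)) ⟩
    sumᶠ R (λ j → sumTuples R (suc m) (λ u → g u j)) ∎

  sumTuples-comm : ∀ m m′ {n n′} (F : (Fin m → Fin n) → (Fin m′ → Fin n′) → Carrier) →
    sumTuples R m (λ u → sumTuples R m′ (F u)) ≈ sumTuples R m′ (λ w → sumTuples R m (λ u → F u w))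
  sumTuples-comm zero    m′ F = refl
  sumTuples-comm (suc m) m′ F = begin
    sumᶠ R (λ i → sumTuples R m (λ u → sumTuples R m′ (F (i ∷ u))))
      ≈⟨ sumᶠ-cong (λ i → sumTuples-comm m m′ (λ u → F (i ∷ u))) ⟩
    sumᶠ R (λ i → sumTuples R m′ (λ w → sumTuples R m (λ u → F (i ∷ u) w)))
      ≈⟨ sumTuples-sumᶠ-comm m′ (λ w i → sumTuples R m (λ u → F (i ∷ u) w)) ⟨
    sumTuples R m′ (λ w → sumTuples R (suc m) (λ u → F u w)) ∎

  prodᶠ-sumᶠ-distrib : ∀ m {n} (g : Fin m → Fin n → Carrier) →
    prodᶠ R (λ l → sumᶠ R (g l)) ≈ sumTuples R m (λ β → prodᶠ R (λ l → g l (β l)))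
  prodᶠ-sumᶠ-distrib zero    g = refl
  prodᶠ-sumᶠ-distrib (suc m) {n} g = begin
    sumᶠ R (g fzero) * rest
      ≈⟨ *-comm _ rest ⟩
    rest * sumᶠ R (g fzero)
      ≈⟨ sumᶠ-*ˡ rest (g fzero) ⟨
    sumᶠ R (λ j → rest * g fzero j)
      ≈⟨ sumᶠ-cong {n} (λ j → *-comm rest (g fzero j)) ⟩
    sumᶠ R (λ j → g fzero j * rest)
      ≈⟨ sumᶠ-cong {n} (λ j → *-congˡ (prodᶠ-sumᶠ-distrib m (λ l → g (fsuc l)))) ⟩
    sumᶠ R (λ j → g fzero j * sumTuples R m (λ β → prodᶠ R (λ l → g (fsuc l) (β l))))
      ≈⟨ sumᶠ-cong {n} (λ j → sumTuples-*ˡ m (g fzero j) _) ⟨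
    sumTuples R (suc m) (λ β → prodᶠ R (λ l → g l (β l))) ∎
    where rest = prodᶠ R (λ l → sumᶠ R (g (fsuc l)))

module PerfectColorings {c ℓ : Level} (R : CommutativeRing c ℓ) where
  open CommutativeRing R
  open SetoidReasoning setoid
  open FiniteSums R

  pow-cong : ∀ {a b} k → a ≈ b → pow R a k ≈ pow R b k
  pow-cong zero    a≈b = refl
  pow-cong (suc k) a≈b = *-cong a≈b (pow-cong k a≈b)

  applyT-matVec : ∀ {m n k} (A : Tensor R m n n) (P : Fin n → Fin k → Carrier) x v →
    applyT R A (matVec R P x) v ≈
    sumTuples R m (λ β → tensorCompMat R A P v β * prodᶠ R (λ l → x (β l)))
  applyT-matVec {m} A P x v = begin
    sumTuples R m (λ u → A v u * prodᶠ R (λ l → matVec R P x (u l)))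
      ≈⟨ sumTuples-cong m (λ u → *-congˡ (prodᶠ-sumᶠ-distrib m (λ l j → P (u l) j * x j))) ⟩
    sumTuples R m (λ u → A v u * sumTuples R m (λ β → term u β))
      ≈⟨ sumTuples-cong m (λ u → sumTuples-*ˡ m (A v u) (term u)) ⟨
    sumTuples R m (λ u → sumTuples R m (λ β → A v u * term u β))
      ≈⟨ sumTuples-comm m m (λ u β → A v u * term u β) ⟩
    sumTuples R m (λ β → sumTuples R m (λ u → A v u * term u β))
      ≈⟨ sumTuples-cong m (λ β → sumTuples-cong m (λ u → split u β)) ⟩
    sumTuples R m (λ β → sumTuples R m (λ u → (A v u * prodᶠ R (λ l → P (u l) (β l))) * xᵝ β))
      ≈⟨ sumTuples-cong m (λ β → sumTuples-*ʳ m (xᵝ β) _) ⟩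
    sumTuples R m (λ β → tensorCompMat R A P v β * xᵝ β) ∎
    where
    xᵝ : (Fin m → Fin _) → Carrier
    xᵝ β = prodᶠ R (λ l → x (β l))
    term : (Fin m → Fin _) → (Fin m → Fin _) → Carrier
    term u β = prodᶠ R (λ l → P (u l) (β l) * x (β l))
    split : ∀ u β → A v u * term u β ≈ (A v u * prodᶠ R (λ l → P (u l) (β l))) * xᵝ β
    split u β = begin
      A v u * term u β
        ≈⟨ *-congˡ (prodᶠ-* (λ l → P (u l) (β l)) (λ l → x (β l))) ⟩
      A v u * (prodᶠ R (λ l → P (u l) (β l)) * xᵝ β)
        ≈⟨ *-assoc _ _ _ ⟨
      (A v u * prodᶠ R (λ l → P (u l) (β l))) * xᵝ β ∎

  colorMatrix-diagonal : ∀ {n k} (f : Fin n → Fin k) v → colorMatrix R f v (f v) ≈ 1#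
  colorMatrix-diagonal f v with f v ≟ f v
  ... | yes _   = refl
  ... | no fv≢fv = contradiction ≡.refl fv≢fv

  colorMatrix-offDiagonal : ∀ {n k} (f : Fin n → Fin k) v i → i ≢ f v → colorMatrix R f v i ≈ 0#
  colorMatrix-offDiagonal f v i i≢fv with f v ≟ i
  ... | yes fv≡i = contradiction (≡.sym fv≡i) i≢fv
  ... | no _     = refl

  matVec-colorMatrix : ∀ {n k} (f : Fin n → Fin k) (x : Fin k → Carrier) v →
    matVec R (colorMatrix R f) x v ≈ x (f v)
  matVec-colorMatrix f x v =
    sumᶠ-select (colorMatrix R f v) x (f v) (colorMatrix-diagonal f v) (colorMatrix-offDiagonal f v)

  matVec-colorMatrix-nonzero : ∀ {n k} (f : Fin n → Fin k) → Surjective R f →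
    (x : Fin k → Carrier) → ¬ (∀ i → x i ≈ 0#) → ¬ (∀ v → matVec R (colorMatrix R f) x v ≈ 0#)
  matVec-colorMatrix-nonzero f surj x x≢0 Px≈0 = x≢0 (λ i → vanishesAt (surj i))
    where
    vanishesAt : ∀ {i} → ∃ (λ v → f v ≡ i) → x i ≈ 0#
    vanishesAt (v , ≡.refl) = trans (sym (matVec-colorMatrix f x v)) (Px≈0 v)

  -- Since (P (S ∘ x))_v = (S ∘ x)_{f v}, this is the identity A ∘ (P x) = P (S ∘ x).
  applyT-perfectColoring : ∀ {m n k} (A : Tensor R m n n) (f : Fin n → Fin k) (S : Tensor R m k k) →
    IsParameterMatrix R A f S → ∀ x v →
    applyT R A (matVec R (colorMatrix R f) x) v ≈ applyT R S x (f v)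
  applyT-perfectColoring {m} A f S A∘P≈P∘S x v = begin
    applyT R A (matVec R (colorMatrix R f) x) v
      ≈⟨ applyT-matVec A (colorMatrix R f) x v ⟩
    sumTuples R m (λ β → tensorCompMat R A (colorMatrix R f) v β * xᵝ β)
      ≈⟨ sumTuples-cong m (λ β → *-congʳ (A∘P≈P∘S v β)) ⟩
    sumTuples R m (λ β → matCompTensor R (colorMatrix R f) S v β * xᵝ β)
      ≈⟨ sumTuples-cong m (λ β → *-congʳ (matVec-colorMatrix f (λ i → S i β) v)) ⟩
    applyT R S x (f v) ∎
    where
    xᵝ : (Fin m → Fin _) → Carrier
    xᵝ β = prodᶠ R (λ l → x (β l))

  isEigenpair-colorMatrix : ∀ {m n k} (A : Tensor R m n n) (f : Fin n → Fin k) (S : Tensor R m k k) →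
    Surjective R f → IsParameterMatrix R A f S → ∀ λ′ x →
    IsEigenpair R S λ′ x → IsEigenpair R A λ′ (matVec R (colorMatrix R f) x)
  isEigenpair-colorMatrix {m} A f S surj A∘P≈P∘S λ′ x (x≢0 , S∘x≈λx) =
    matVec-colorMatrix-nonzero f surj x x≢0 , A∘Px≈λPx
    where
    A∘Px≈λPx : ∀ v → applyT R A (matVec R (colorMatrix R f) x) v ≈
                     λ′ * identityApply R {m} (matVec R (colorMatrix R f) x) v
    A∘Px≈λPx v = begin
      applyT R A (matVec R (colorMatrix R f) x) v        ≈⟨ applyT-perfectColoring A f S A∘P≈P∘S x v ⟩
      applyT R S x (f v)                                 ≈⟨ S∘x≈λx (f v) ⟩
      λ′ * pow R (x (f v)) m                             ≈⟨ *-congˡ (pow-cong m (matVec-colorMatrix f x v)) ⟨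
      λ′ * pow R (matVec R (colorMatrix R f) x v) m      ∎

open PerfectColorings using (isEigenpair-colorMatrix)

theorem8 : ∀ {c ℓ : Level} (R : CommutativeRing c ℓ) (m n k : ℕ) → 1 ≤ m →
    (inv : CommutativeRing.Carrier R) →
    CommutativeRing._≈_ R (CommutativeRing._*_ R inv (ℕtoR R (m !))) (CommutativeRing.1# R) →
    (G : UniformHypergraph (suc m) n) (f : Fin n → Fin k) → Surjective R f →
    (S : Tensor R m k k) → IsParameterMatrix R (adjacency R G inv) f S →
    (λ' : CommutativeRing.Carrier R) (x : Fin k → CommutativeRing.Carrier R) →
    IsEigenpair R S λ' x →
    IsEigenpair R (adjacency R G inv) λ' (matVec R (colorMatrix R f) x)
theorem8 R m n k _ inv _ G f surj S isParameterMatrix =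
  isEigenpair-colorMatrix R (adjacency R G inv) f S surj isParameterMatrix
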